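{- A connected graph $G$ is $(\iota,1)$-critical if and only if, for every minimum isolating set $D$ of $G$, the triple $(D,\,N(D),\,V(G)\setminus N[D])$ is a critical tripartition of $G$.
   Context: For $D\subseteq V(G)$, $N[D]$ is the set of vertices of $D$ and all their neighbours, and $N(D)=N[D]\setminus D$. $D$ is an isolating set of $G$ if $G-N[D]$ has no edges; $\iota(G)$ is the minimum size of an isolating set, and a minimum isolating set is one of size $\iota(G)$. For $e\in E(G)$, $G_e$ is obtained by subdividing $e$ once. $G$ is $(\iota,1)$-critical if $\iota(G_e)>\iota(G)$ for every edge $e\in E(G)$ (and $E(G)\neq\emptyset$). A set $S$ is a $3$-packing if any two distinct vertices of $S$ are at distance greater than $3$. A triple $(A,B,C)$ of non-empty sets partitioning $V(G)$ is a critical tripartition of $G$ if: (i) $A\cup C$ and $B$ are independent sets of $G$; (ii) $N(A)=B=N(C)$; (iii) $A$ is a $3$-packing of $G$; (iv) no vertex of $A$ is a leaf (degree-one vertex) of $G$. -}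

module Defs where

open import Data.Nat using (ℕ; zero; suc; _≤_; _<_)
open import Data.Fin using (Fin; zero; suc; _≟_)
open import Data.Fin.Subset using (Subset; _∈_; _∉_; ∣_∣)
open import Data.Bool using (Bool; true; false; T; _∧_; _∨_; not)
open import Data.Product using (Σ; ∃; ∃-syntax; _×_; _,_)
open import Data.Sum using (_⊎_)
open import Data.Empty using (⊥)
open import Relation.Nullary using (¬_; does)
open import Relation.Binary.PropositionalEquality using (_≡_; _≢_)

record Graph (n : ℕ) : Set where
  field
    adj   : Fin n → Fin n → Bool
    sym   : ∀ x y → adj x y ≡ adj y x
    irrefl : ∀ x → adj x x ≡ false
open Graph public

-- All graph notions below are stated for an arbitrary adjacency matrix,
-- so that they apply verbatim to the subdivided graph G_e.
module _ {n : ℕ} (adj : Fin n → Fin n → Bool) where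

  Adj : Fin n → Fin n → Set
  Adj x y = T (adj x y)

  InClosedNbhd : Subset n → Fin n → Set
  InClosedNbhd D x = x ∈ D ⊎ (∃[ y ] (y ∈ D × Adj x y))

  InOpenNbhd : Subset n → Fin n → Set
  InOpenNbhd D x = x ∉ D × (∃[ y ] (y ∈ D × Adj x y))

  Isolating : Subset n → Set
  Isolating D = ∀ x y → Adj x y → InClosedNbhd D x ⊎ InClosedNbhd D y

  MinIsolating : Subset n → Set
  MinIsolating D = Isolating D × (∀ D' → Isolating D' → ∣ D ∣ ≤ ∣ D' ∣)

  data Walk : ℕ → Fin n → Fin n → Set where
    here : ∀ {x} → Walk zero x x
    step : ∀ {k x y z} → Adj x y → Walk k y z → Walk (suc k) x z

  Connected : Set
  Connected = ∀ x y → ∃[ k ] Walk k x y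

  HasEdge : Set
  HasEdge = ∃[ x ] ∃[ y ] Adj x y

  DistGt3 : Fin n → Fin n → Set
  DistGt3 x y = ∀ k → k ≤ 3 → ¬ Walk k x y

  ThreePacking : (Fin n → Set) → Set
  ThreePacking S = ∀ x y → S x → S y → x ≢ y → DistGt3 x y

  IsLeaf : Fin n → Set
  IsLeaf x = ∃[ y ] (Adj x y × (∀ z → Adj x z → z ≡ y))

  Independent : (Fin n → Set) → Set
  Independent S = ∀ x y → S x → S y → ¬ Adj x y

  NonEmpty : (Fin n → Set) → Set
  NonEmpty S = ∃[ x ] S x

  InOpenNbhdP : (Fin n → Set) → Fin n → Set
  InOpenNbhdP S x = ¬ S x × (∃[ y ] (S y × Adj x y))

  SameSet : (Fin n → Set) → (Fin n → Set) → Set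
  SameSet S T' = (∀ x → S x → T' x) × (∀ x → T' x → S x)

  record CriticalTripartition (A B C : Fin n → Set) : Set where
    field
      neA : NonEmpty A
      neB : NonEmpty B
      neC : NonEmpty C
      cover : ∀ x → A x ⊎ B x ⊎ C x
      disjAB : ∀ x → A x → B x → ⊥
      disjAC : ∀ x → A x → C x → ⊥
      disjBC : ∀ x → B x → C x → ⊥
      indepAC : Independent (λ x → A x ⊎ C x)
      indepB : Independent B
      NA≡B : SameSet (InOpenNbhdP A) B
      NC≡B : SameSet (InOpenNbhdP C) B
      packA : ThreePacking A
      noLeafA : ∀ x → A x → ¬ IsLeaf x

-- Subdivision G_e of the edge e = uv: the new vertex is zero,
-- old vertex a becomes suc a.
subdivide : {n : ℕ} → (Fin n → Fin n → Bool) → Fin n → Fin n →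
            Fin (suc n) → Fin (suc n) → Bool
subdivide adj u v zero zero = false
subdivide adj u v zero (suc b) = does (b ≟ u) ∨ does (b ≟ v)
subdivide adj u v (suc a) zero = does (a ≟ u) ∨ does (a ≟ v)
subdivide adj u v (suc a) (suc b) =
  adj a b ∧ not ((does (a ≟ u) ∧ does (b ≟ v)) ∨ (does (a ≟ v) ∧ does (b ≟ u)))

-- ι(G) < ι(G_e): every isolating set of G_e is strictly larger than
-- some isolating set of G.
IotaIncreases : {n : ℕ} → (Fin n → Fin n → Bool) → Fin n → Fin n → Set
IotaIncreases {n} adj u v =
  ∀ (D' : Subset (suc n)) → Isolating (subdivide adj u v) D' →
    ∃[ D ] (Isolating adj D × ∣ D ∣ < ∣ D' ∣)

IotaOneCritical : {n : ℕ} → Graph n → Set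
IotaOneCritical G =
  HasEdge (adj G) × (∀ u v → Adj (adj G) u v → IotaIncreases (adj G) u v)

{-# OPTIONS --safe #-}
-- Let G_uv be G with the edge uv subdivided by a new vertex w.  A set D ⊆ V(G)
-- stays isolating in G_uv as soon as w, or both u and v, remain dominated and
-- every vertex that loses its domination has no edge left.  If G is
-- (ι,1)-critical this must fail for a minimum D and every edge, which forces
-- D and N(D) to be independent and every vertex of N(D) to have exactly one
-- neighbour in D and at least one outside N[D]: the critical tripartition.  A
-- leaf x ∈ D with neighbour b could be traded for b, giving a minimum
-- isolating set in which x has no neighbour outside N[D].
--
-- Conversely, an isolating set of G_uv projects to an isolating set of G that
-- is no larger (drop w, adding u if w was used).  If it were minimum, its
-- tripartition would leave undominated the edge from the N(D)-endpoint of uv,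
-- or from a second neighbour of u, to a vertex outside N[D].
module Submission where

open import Defs hiding (sym)
open import Data.Bool using (Bool; true; false; T)
open import Data.Bool.Properties using (T-∧)
open import Data.Empty using (⊥; ⊥-elim)
open import Data.Fin using (Fin; zero; suc; _≟_)
open import Data.Fin.Properties using (any?; all?)
open import Data.Fin.Subset
  using (Subset; _∈_; _∉_; _⊆_; ∣_∣; _∪_; ⁅_⁆; _-_; inside; outside)
  renaming (⊥ to ∅)
open import Data.Fin.Subset.Properties
  using ( _∈?_; anySubset?; ∉⊥; ∣⊥∣≡0; ∪-identityʳ; p⊆p∪q; x∈p∪q⁺; x∈p∪q⁻; x∈⁅x⁆; x∈⁅y⁆⇒x≡y
        ; x∈p∧x≢y⇒x∈p-y; x∈p⇒∣p-x∣<∣p∣)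
open import Data.Nat using (ℕ; zero; suc; _≤_; z≤n; s≤s)
open import Data.Nat.Properties using (≤-trans; ≤-refl; ≤-reflexive; n≤1+n; n≮n; ≮⇒≥; _<?_)
open import Data.Product using (∃-syntax; _×_; _,_; proj₁; proj₂)
import Data.Product as Product
open import Data.Product.Function.NonDependent.Propositional using (_×-⇔_)
open import Data.Sum using (_⊎_; inj₁; inj₂; [_,_]; swap) renaming (map to ⊎-map)
open import Data.Vec.Base using (_∷_; there)
open import Function using (_∘_; id; _⇔_; mk⇔; Equivalence)
import Function.Properties.Equivalence as ⇔
open import Relation.Nullary using (¬_; Dec; yes; no; does)
open import Relation.Nullary.Decidable using (_×-dec_; _⊎-dec_; _→-dec_; ¬?; T?; decidable-stable)
open import Relation.Binary.PropositionalEquality using (_≡_; _≢_; refl; sym; subst)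

open Equivalence using (to; from)

T-does : ∀ {a} {A : Set a} (a? : Dec A) → T (does a?) ⇔ A
T-does (yes a) = mk⇔ (λ _ → a) (λ _ → _)
T-does (no ¬a) = mk⇔ (λ ()) ¬a

∣p∪⁅x⁆∣≤1+∣p∣ : ∀ {n} (p : Subset n) x → ∣ p ∪ ⁅ x ⁆ ∣ ≤ suc ∣ p ∣
∣p∪⁅x⁆∣≤1+∣p∣ (true  ∷ p) zero rewrite ∪-identityʳ p = n≤1+n _
∣p∪⁅x⁆∣≤1+∣p∣ (false ∷ p) zero rewrite ∪-identityʳ p = ≤-refl
∣p∪⁅x⁆∣≤1+∣p∣ (true  ∷ p) (suc x) = s≤s (∣p∪⁅x⁆∣≤1+∣p∣ p x)
∣p∪⁅x⁆∣≤1+∣p∣ (false ∷ p) (suc x) = ∣p∪⁅x⁆∣≤1+∣p∣ p x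

x∉p-x : ∀ {n} (p : Subset n) x → x ∉ p - x
x∉p-x (_ ∷ p) zero ()
x∉p-x (_ ∷ p) (suc x) (there x∈p-x) = x∉p-x p x x∈p-x

module _ {n : ℕ} (G : Graph n) where

  private
    variable
      x y z p q : Fin n
      s : Bool
      D S : Subset n

  infix 4 _~_ _∈N[_] _∈N⟨_⟩

  _~_ : Fin n → Fin n → Set
  x ~ y = Adj (adj G) x y

  _∈N[_] : Fin n → Subset n → Set
  x ∈N[ D ] = InClosedNbhd (adj G) D x

  _∈N⟨_⟩ : Fin n → Subset n → Set
  x ∈N⟨ D ⟩ = InOpenNbhd (adj G) D x

  CriticalTripartitionOf : Subset n → Set
  CriticalTripartitionOf D =
    CriticalTripartition (adj G) (_∈ D) (_∈N⟨ D ⟩) (λ x → ¬ x ∈N[ D ])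

  ~-sym : x ~ y → y ~ x
  ~-sym {x} {y} = subst T (Graph.sym G x y)

  ~-irrefl : x ~ y → x ≢ y
  ~-irrefl {x} xy refl = subst T (irrefl G x) xy

  closedNbhd? : ∀ D x → Dec (x ∈N[ D ])
  closedNbhd? D x = (x ∈? D) ⊎-dec any? (λ y → (y ∈? D) ×-dec T? (adj G x y))

  isolating? : ∀ D → Dec (Isolating (adj G) D)
  isolating? D =
    all? λ x → all? λ y → T? (adj G x y) →-dec (closedNbhd? D x ⊎-dec closedNbhd? D y)

  closed⇒open : x ∉ D → x ∈N[ D ] → x ∈N⟨ D ⟩
  closed⇒open x∉D (inj₁ x∈D) = ⊥-elim (x∉D x∈D)
  closed⇒open x∉D (inj₂ nbr) = x∉D , nbr

  trichotomy : ∀ x → x ∈ D ⊎ x ∈N⟨ D ⟩ ⊎ ¬ x ∈N[ D ]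
  trichotomy {D} x with x ∈? D | closedNbhd? D x
  ... | yes x∈D | _     = inj₁ x∈D
  ... | no x∉D  | yes c = inj₂ (inj₁ (closed⇒open x∉D c))
  ... | no _    | no ¬c = inj₂ (inj₂ ¬c)

  isolating-mono : (∀ {x} → x ∈N[ D ] → x ∈N[ S ]) →
                   Isolating (adj G) D → Isolating (adj G) S
  isolating-mono D⊆S isoD x y xy = ⊎-map D⊆S D⊆S (isoD x y xy)

  minIsolating : ∀ {k} → Isolating (adj G) D → ∣ D ∣ ≤ k →
                 (∀ D′ → Isolating (adj G) D′ → k ≤ ∣ D′ ∣) → MinIsolating (adj G) D
  minIsolating isoD size lower = isoD , λ D′ isoD′ → ≤-trans size (lower D′ isoD′)

  module Tripartition (ct : CriticalTripartitionOf S) where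
    open CriticalTripartition ct

    nbr-in-nbhd : x ∈ S → x ~ y → y ∈N⟨ S ⟩
    nbr-in-nbhd x∈S xy = (λ y∈S → indepAC _ _ (inj₁ x∈S) (inj₁ y∈S) xy) , _ , x∈S , ~-sym xy

    outer-nbr : x ∈N⟨ S ⟩ → ∃[ c ] (x ~ c × ¬ c ∈N[ S ])
    outer-nbr x∈N with proj₂ NC≡B _ x∈N
    ... | _ , c , c∉N , xc = c , xc , c∉N

    unique-nbr : x ∈ S → y ∈ S → x ~ z → z ~ y → x ≡ y
    unique-nbr {x} {y} x∈S y∈S xz zy = decidable-stable (x ≟ y) λ x≢y →
      packA x y x∈S y∈S x≢y 2 (s≤s (s≤s z≤n)) (step xz (step zy here))

  module Subdivision (u v : Fin n) where

    adjₑ : Fin (suc n) → Fin (suc n) → Bool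
    adjₑ = subdivide (adj G) u v

    -- G − uv, i.e. G_uv restricted to the old vertices.
    adj⁻ : Fin n → Fin n → Bool
    adj⁻ x y = adjₑ (suc x) (suc y)

    infix 4 _∈N⁻[_] _∈Nₑ[_]

    _∈N⁻[_] : Fin n → Subset n → Set
    x ∈N⁻[ D ] = InClosedNbhd adj⁻ D x

    _∈Nₑ[_] : Fin (suc n) → Subset (suc n) → Set
    x ∈Nₑ[ D ] = InClosedNbhd adjₑ D x

    Endpoint : Fin n → Set
    Endpoint x = x ≡ u ⊎ x ≡ v

    SameEdge : Fin n → Fin n → Set
    SameEdge x y = (x ≡ u × y ≡ v) ⊎ (x ≡ v × y ≡ u)

    endpoint? : ∀ x → Dec (Endpoint x)
    endpoint? x = (x ≟ u) ⊎-dec (x ≟ v)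

    sameEdge? : ∀ x y → Dec (SameEdge x y)
    sameEdge? x y = ((x ≟ u) ×-dec (y ≟ v)) ⊎-dec ((x ≟ v) ×-dec (y ≟ u))

    -- The tests in subdivide are definitionally does (endpoint? x) and
    -- not (does (sameEdge? x y)).
    new~old : Adj adjₑ zero (suc x) ⇔ Endpoint x
    new~old {x} = T-does (endpoint? x)

    old~new : Adj adjₑ (suc x) zero ⇔ Endpoint x
    old~new {x} = T-does (endpoint? x)

    old~old : Adj adj⁻ x y ⇔ (x ~ y × ¬ SameEdge x y)
    old~old {x} {y} = ⇔.trans T-∧ (⇔.refl ×-⇔ T-does (¬? (sameEdge? x y)))

    sameEdge-sym : SameEdge x y → SameEdge y x
    sameEdge-sym = swap ∘ ⊎-map Product.swap Product.swap

    sameEdge⇒endpoint : SameEdge x y → Endpoint x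
    sameEdge⇒endpoint = ⊎-map proj₁ proj₁

    sameEdge-adj : u ~ v → SameEdge x y → x ~ y
    sameEdge-adj uv (inj₁ (refl , refl)) = uv
    sameEdge-adj uv (inj₂ (refl , refl)) = ~-sym uv

    endpoint-of : SameEdge x y → Endpoint z → z ≡ x ⊎ z ≡ y
    endpoint-of (inj₁ (refl , refl)) (inj₁ refl) = inj₁ refl
    endpoint-of (inj₁ (refl , refl)) (inj₂ refl) = inj₂ refl
    endpoint-of (inj₂ (refl , refl)) (inj₁ refl) = inj₂ refl
    endpoint-of (inj₂ (refl , refl)) (inj₂ refl) = inj₁ refl

    endpoint∈N : u ~ v → u ∈ S → Endpoint x → x ∈N[ S ]
    endpoint∈N uv u∈S (inj₁ refl) = inj₁ u∈S
    endpoint∈N uv u∈S (inj₂ refl) = inj₂ (u , u∈S , ~-sym uv)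

    N⁻⊆N : D ⊆ S → x ∈N⁻[ D ] → x ∈N[ S ]
    N⁻⊆N D⊆S (inj₁ x∈D)           = inj₁ (D⊆S x∈D)
    N⁻⊆N D⊆S (inj₂ (d , d∈D , xd)) = inj₂ (d , D⊆S d∈D , proj₁ (to old~old xd))

    closedNbhd⁻ : (∀ {d} → d ∈ D → ¬ SameEdge x d) → x ∈N[ D ] → x ∈N⁻[ D ]
    closedNbhd⁻ _     (inj₁ x∈D)           = inj₁ x∈D
    closedNbhd⁻ ¬same (inj₂ (d , d∈D , xd)) = inj₂ (d , d∈D , from old~old (xd , ¬same d∈D))

    lift-closedNbhd : x ∈N⁻[ D ] → suc x ∈Nₑ[ s ∷ D ]
    lift-closedNbhd (inj₁ x∈D)           = inj₁ (there x∈D)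
    lift-closedNbhd (inj₂ (d , d∈D , xd)) = inj₂ (suc d , there d∈D , xd)

    project-closedNbhd : suc x ∈Nₑ[ s ∷ D ] → x ∈N⁻[ D ] ⊎ (zero ∈ s ∷ D × Endpoint x)
    project-closedNbhd (inj₁ (there x∈D))              = inj₁ (inj₁ x∈D)
    project-closedNbhd (inj₂ (zero , w∈D , xw))        = inj₂ (w∈D , to old~new xw)
    project-closedNbhd (inj₂ (suc d , there d∈D , xd)) = inj₁ (inj₂ (d , d∈D , xd))

    project-closedNbhd-new : zero ∈Nₑ[ s ∷ D ] → zero ∈ s ∷ D ⊎ ∃[ d ] (d ∈ D × Endpoint d)
    project-closedNbhd-new (inj₁ w∈D)                   = inj₁ w∈D
    project-closedNbhd-new (inj₂ (suc d , there d∈D , wd)) = inj₂ (d , d∈D , to new~old wd)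

    isolating⁻ : Isolating (adj G) D →
                 (∀ p q → Endpoint p → Adj adj⁻ p q → p ∈N[ D ] → p ∈N⁻[ D ]) →
                 Isolating adj⁻ D
    isolating⁻ {D} isoD keep x y xy =
      ⊎-map (stays x y xy) (stays y x yx) (isoD x y (proj₁ (to old~old xy)))
      where
      yx : Adj adj⁻ y x
      yx = from old~old (Product.map ~-sym (_∘ sameEdge-sym) (to old~old xy))
      stays : ∀ p q → Adj adj⁻ p q → p ∈N[ D ] → p ∈N⁻[ D ]
      stays p q pq with endpoint? p
      ... | yes end = keep p q end pq
      ... | no ¬end = closedNbhd⁻ λ _ → ¬end ∘ sameEdge⇒endpoint

    NewEdgesCovered : Subset n → Set
    NewEdgesCovered D = ∃[ d ] (d ∈ D × Endpoint d) ⊎ (u ∈N⁻[ D ] × v ∈N⁻[ D ])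

    isolating-outside⇔ : Isolating adjₑ (outside ∷ D) ⇔ (Isolating adj⁻ D × NewEdgesCovered D)
    isolating-outside⇔ {D} = mk⇔ (λ iso → restrict iso , endpoints iso) extend
      where
      old : suc x ∈Nₑ[ outside ∷ D ] → x ∈N⁻[ D ]
      old c with project-closedNbhd c
      ... | inj₁ c⁻ = c⁻

      new : zero ∈Nₑ[ outside ∷ D ] → ∃[ d ] (d ∈ D × Endpoint d)
      new c with project-closedNbhd-new c
      ... | inj₂ end = end

      restrict : Isolating adjₑ (outside ∷ D) → Isolating adj⁻ D
      restrict iso x y xy = ⊎-map old old (iso (suc x) (suc y) xy)

      endpoints : Isolating adjₑ (outside ∷ D) → NewEdgesCovered D
      endpoints iso with iso zero (suc u) (from new~old (inj₁ refl))
                       | iso zero (suc v) (from new~old (inj₂ refl))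
      ... | inj₁ cw | _       = inj₁ (new cw)
      ... | inj₂ _  | inj₁ cw = inj₁ (new cw)
      ... | inj₂ cu | inj₂ cv = inj₂ (old cu , old cv)

      new-edge : NewEdgesCovered D → Endpoint x → zero ∈Nₑ[ outside ∷ D ] ⊎ suc x ∈Nₑ[ outside ∷ D ]
      new-edge (inj₁ (d , d∈D , d-end)) _ = inj₁ (inj₂ (suc d , there d∈D , from new~old d-end))
      new-edge (inj₂ (cu , cv)) end =
        inj₂ (lift-closedNbhd ([ (λ { refl → cu }) , (λ { refl → cv }) ] end))

      extend : Isolating adj⁻ D × NewEdgesCovered D → Isolating adjₑ (outside ∷ D)
      extend (iso⁻ , cov) zero    zero    ()
      extend (iso⁻ , cov) zero    (suc x) wx = new-edge cov (to new~old wx)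
      extend (iso⁻ , cov) (suc x) zero    xw = swap (new-edge cov (to old~new xw))
      extend (iso⁻ , cov) (suc x) (suc y) xy = ⊎-map lift-closedNbhd lift-closedNbhd (iso⁻ x y xy)

    module Projection (uv : u ~ v) (D⊆S : D ⊆ S) (w⇒u : zero ∈ s ∷ D → u ∈ S) where

      old-covered : suc x ∈Nₑ[ s ∷ D ] → x ∈N[ S ]
      old-covered c with project-closedNbhd c
      ... | inj₁ c⁻          = N⁻⊆N D⊆S c⁻
      ... | inj₂ (w∈D , end) = endpoint∈N uv (w⇒u w∈D) end

      new-covered : zero ∈Nₑ[ s ∷ D ] → ∃[ z ] (Endpoint z × z ∈N[ S ])
      new-covered c with project-closedNbhd-new c
      ... | inj₁ w∈D               = u , inj₁ refl , inj₁ (w⇒u w∈D)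
      ... | inj₂ (d , d∈D , d-end) = d , d-end , inj₁ (D⊆S d∈D)

      endpoint-covered : Isolating adjₑ (s ∷ D) → ∃[ z ] (Endpoint z × z ∈N[ S ])
      endpoint-covered iso with iso zero (suc u) (from new~old (inj₁ refl))
      ... | inj₁ cw = new-covered cw
      ... | inj₂ cu = u , inj₁ refl , old-covered cu

      edge-covered : SameEdge x y → ∃[ z ] (Endpoint z × z ∈N[ S ]) → x ∈N[ S ] ⊎ y ∈N[ S ]
      edge-covered same (z , end , c) with endpoint-of same end
      ... | inj₁ refl = inj₁ c
      ... | inj₂ refl = inj₂ c

      project-isolating : Isolating adjₑ (s ∷ D) → Isolating (adj G) S
      project-isolating iso x y xy with sameEdge? x y
      ... | yes same = edge-covered same (endpoint-covered iso)
      ... | no ¬same =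
        ⊎-map old-covered old-covered (iso (suc x) (suc y) (from old~old (xy , ¬same)))

    endpoint∉ : u ∉ D → v ∉ D → Endpoint x → x ∉ D
    endpoint∉ u∉D _   (inj₁ refl) = u∉D
    endpoint∉ _   v∉D (inj₂ refl) = v∉D

    endpoint∈D⇒¬isolating⁻ : u ~ v → CriticalTripartitionOf D → p ∈ D → SameEdge p q →
                             ¬ Isolating adj⁻ D
    endpoint∈D⇒¬isolating⁻ {D} {p} {q} uv ct p∈D pq iso⁻ = uncovered (outer-nbr q∈N)
      where
      open Tripartition ct
      p~q : p ~ q
      p~q = sameEdge-adj uv pq
      q∈N : q ∈N⟨ D ⟩
      q∈N = nbr-in-nbhd p∈D p~q
      q-uncovered : ¬ q ∈N⁻[ D ]
      q-uncovered (inj₁ q∈D) = proj₁ q∈N q∈D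
      q-uncovered (inj₂ (d , d∈D , qd)) with to old~old qd
      ... | q~d , ¬same = ¬same (subst (SameEdge q) (unique-nbr p∈D d∈D p~q q~d) (sameEdge-sym pq))
      uncovered : ∃[ c ] (q ~ c × ¬ c ∈N[ D ]) → ⊥
      uncovered (c , qc , c∉N) =
        [ q-uncovered , c∉N ∘ N⁻⊆N id ] (iso⁻ q c (from old~old (qc , ¬same)))
        where
        ¬same : ¬ SameEdge q c
        ¬same qc-same with endpoint-of pq (sameEdge⇒endpoint (sameEdge-sym qc-same))
        ... | inj₁ c≡p = c∉N (inj₁ (subst (_∈ D) (sym c≡p) p∈D))
        ... | inj₂ c≡q = ~-irrefl qc (sym c≡q)

    ¬isolating-outside : u ~ v → CriticalTripartitionOf D → ¬ Isolating adjₑ (outside ∷ D)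
    ¬isolating-outside {D} uv ct iso with u ∈? D | v ∈? D | to isolating-outside⇔ iso
    ... | yes u∈D | yes v∈D | _        =
      CriticalTripartition.indepAC ct u v (inj₁ u∈D) (inj₁ v∈D) uv
    ... | yes u∈D | no _    | iso⁻ , _ = endpoint∈D⇒¬isolating⁻ uv ct u∈D (inj₁ (refl , refl)) iso⁻
    ... | no _    | yes v∈D | iso⁻ , _ = endpoint∈D⇒¬isolating⁻ uv ct v∈D (inj₂ (refl , refl)) iso⁻
    ... | no u∉D  | no v∉D  | _ , inj₁ (d , d∈D , d-end) = endpoint∉ u∉D v∉D d-end d∈D
    ... | no u∉D  | no v∉D  | _ , inj₂ (cu , cv) =
      CriticalTripartition.indepB ct u v (closed⇒open u∉D (N⁻⊆N id cu))
                                         (closed⇒open v∉D (N⁻⊆N id cv)) uv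

    ¬isolating-inside : u ~ v → CriticalTripartitionOf S → D ⊆ S → u ∈ S → u ∉ D →
                        ¬ Isolating adjₑ (inside ∷ D)
    ¬isolating-inside {S} {D} uv ct D⊆S u∈S u∉D iso =
      noLeafA u u∈S (v , uv , λ z uz → decidable-stable (z ≟ v) (other-nbr uz))
      where
      open CriticalTripartition ct
      open Tripartition ct
      open Projection {s = inside} uv D⊆S (λ _ → u∈S)
      other-nbr : u ~ x → x ≢ v → ⊥
      other-nbr {x} ux x≢v = uncovered (outer-nbr x∈N)
        where
        x∈N : x ∈N⟨ S ⟩
        x∈N = nbr-in-nbhd u∈S ux
        ¬end : ¬ Endpoint x
        ¬end = [ ~-irrefl ux ∘ sym , x≢v ]
        x-uncovered : ¬ suc x ∈Nₑ[ inside ∷ D ]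
        x-uncovered c with project-closedNbhd c
        ... | inj₁ (inj₁ x∈D) = proj₁ x∈N (D⊆S x∈D)
        ... | inj₁ (inj₂ (d , d∈D , xd)) =
          u∉D (subst (_∈ D) (sym (unique-nbr u∈S (D⊆S d∈D) ux (proj₁ (to old~old xd)))) d∈D)
        ... | inj₂ (_ , end) = ¬end end
        uncovered : ∃[ c ] (x ~ c × ¬ c ∈N[ S ]) → ⊥
        uncovered (c , xc , c∉N) = [ x-uncovered , c∉N ∘ old-covered ]
          (iso (suc x) (suc c) (from old~old (xc , ¬end ∘ sameEdge⇒endpoint)))

    no-isolating-minimum : u ~ v → (∀ D → MinIsolating (adj G) D → CriticalTripartitionOf D) →
      ∀ D′ → Isolating adjₑ D′ → ¬ (∀ D → Isolating (adj G) D → ∣ D′ ∣ ≤ ∣ D ∣)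
    no-isolating-minimum uv tri (outside ∷ D) iso lower =
      ¬isolating-outside uv (tri D (minIsolating isoD ≤-refl lower)) iso
      where
      isoD : Isolating (adj G) D
      isoD = Projection.project-isolating uv id (λ ()) iso
    no-isolating-minimum uv tri (inside ∷ D) iso lower with u ∈? D
    ... | yes u∈D = n≮n _ (lower D (Projection.project-isolating uv id (λ _ → u∈D) iso))
    ... | no u∉D = ¬isolating-inside uv (tri D+u (minIsolating isoD+u (∣p∪⁅x⁆∣≤1+∣p∣ D u) lower))
                                        (p⊆p∪q ⁅ u ⁆) u∈D+u u∉D iso
      where
      D+u : Subset n
      D+u = D ∪ ⁅ u ⁆
      u∈D+u : u ∈ D+u
      u∈D+u = x∈p∪q⁺ (inj₂ (x∈⁅x⁆ u))
      isoD+u : Isolating (adj G) D+u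
      isoD+u = Projection.project-isolating uv (p⊆p∪q ⁅ u ⁆) (λ _ → u∈D+u) iso

  Rigid : Subset n → Set
  Rigid D = ∀ u v → u ~ v → ¬ Isolating (subdivide (adj G) u v) (outside ∷ D)

  EdgeCritical : Set
  EdgeCritical = ∀ u v → u ~ v → IotaIncreases (adj G) u v

  critical⇒rigid : EdgeCritical → MinIsolating (adj G) D → Rigid D
  critical⇒rigid crit (_ , lower) u v uv iso with crit u v uv (outside ∷ _) iso
  ... | D₀ , isoD₀ , smaller = n≮n _ (≤-trans smaller (lower D₀ isoD₀))

  module Rigidity (isoD : Isolating (adj G) D) (rigid : Rigid D) where

    independent : x ∈ D → y ∈ D → ¬ x ~ y
    independent {x} {y} x∈D y∈D xy =
      rigid x y xy (from isolating-outside⇔ (isolating⁻ isoD keep , inj₁ (x , x∈D , inj₁ refl)))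
      where
      open Subdivision x y
      keep : ∀ p q → Endpoint p → Adj adj⁻ p q → p ∈N[ D ] → p ∈N⁻[ D ]
      keep p q (inj₁ refl) _ _ = inj₁ x∈D
      keep p q (inj₂ refl) _ _ = inj₁ y∈D

    nbr-in-nbhd : x ∈ D → x ~ y → y ∈N⟨ D ⟩
    nbr-in-nbhd x∈D xy = (λ y∈D → independent x∈D y∈D xy) , _ , x∈D , ~-sym xy

    nbhd-independent : x ∈N⟨ D ⟩ → y ∈N⟨ D ⟩ → ¬ x ~ y
    nbhd-independent {x} {y} (x∉D , x-nbr) (y∉D , y-nbr) xy =
      rigid x y xy (from isolating-outside⇔
        (isolating⁻ isoD (λ _ _ _ _ → kept) , inj₂ (kept (inj₂ x-nbr) , kept (inj₂ y-nbr))))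
      where
      open Subdivision x y
      kept : z ∈N[ D ] → z ∈N⁻[ D ]
      kept = closedNbhd⁻ λ d∈D same →
        endpoint∉ x∉D y∉D (sameEdge⇒endpoint (sameEdge-sym same)) d∈D

    unique-nbr : x ∈ D → y ∈ D → x ~ z → z ~ y → x ≡ y
    unique-nbr {x} {y} {z} x∈D y∈D xz zy = decidable-stable (x ≟ y) λ x≢y →
      rigid x z xz
        (from isolating-outside⇔ (isolating⁻ isoD (keep x≢y) , inj₁ (x , x∈D , inj₁ refl)))
      where
      open Subdivision x z
      z∉D : z ∉ D
      z∉D = proj₁ (nbr-in-nbhd x∈D xz)
      keep : x ≢ y → ∀ p q → Endpoint p → Adj adj⁻ p q → p ∈N[ D ] → p ∈N⁻[ D ]
      keep _   p q (inj₁ refl) _ _ = inj₁ x∈D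
      keep x≢y p q (inj₂ refl) _ _ = inj₂ (y , y∈D , from old~old (zy , λ where
        (inj₁ (z≡x , _)) → z∉D (subst (_∈ D) (sym z≡x) x∈D)
        (inj₂ (_ , y≡x)) → x≢y (sym y≡x)))

    outer-nbr : x ∈N⟨ D ⟩ → ∃[ c ] (x ~ c × ¬ c ∈N[ D ])
    outer-nbr {b} (b∉D , d , d∈D , bd) =
      decidable-stable (any? λ c → T? (adj G b c) ×-dec ¬? (closedNbhd? D c)) λ none →
        rigid d b (~-sym bd)
          (from isolating-outside⇔ (isolating⁻ isoD (keep none) , inj₁ (d , d∈D , inj₁ refl)))
      where
      -- Otherwise b hangs from d alone, and subdividing db keeps D isolating.
      open Subdivision d b
      only-d : ¬ (∃[ c ] (b ~ c × ¬ c ∈N[ D ])) → b ~ z → z ≡ d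
      only-d {z} none bz
        with z ∈? D | decidable-stable (closedNbhd? D z) (λ z∉N → none (z , bz , z∉N))
      ... | yes z∈D | _  = sym (unique-nbr d∈D z∈D (~-sym bd) bz)
      ... | no z∉D  | zN = ⊥-elim (nbhd-independent (b∉D , d , d∈D , bd) (closed⇒open z∉D zN) bz)
      keep : ¬ (∃[ c ] (b ~ c × ¬ c ∈N[ D ])) →
             ∀ p q → Endpoint p → Adj adj⁻ p q → p ∈N[ D ] → p ∈N⁻[ D ]
      keep _    p q (inj₁ refl) _  _ = inj₁ d∈D
      keep none p q (inj₂ refl) pq _ with to old~old pq
      ... | bq , ¬same = ⊥-elim (¬same (inj₂ (refl , only-d none bq)))

    packing : ThreePacking (adj G) (_∈ D)
    packing x y x∈D y∈D x≢y _ _ here                     = x≢y refl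
    packing x y x∈D y∈D x≢y _ _ (step xy here)           = independent x∈D y∈D xy
    packing x y x∈D y∈D x≢y _ _ (step xz (step zy here)) = x≢y (unique-nbr x∈D y∈D xz zy)
    packing x y x∈D y∈D x≢y _ _ (step xz (step zw (step wy here))) =
      nbhd-independent (nbr-in-nbhd x∈D xz) (nbr-in-nbhd y∈D (~-sym wy)) zw
    packing _ _ _ _ _ _ (s≤s (s≤s (s≤s ()))) (step _ (step _ (step _ (step _ _))))

    meets-nbhd : x ~ y → x ∈N[ D ] → ∃[ b ] b ∈N⟨ D ⟩
    meets-nbhd {x} {y} xy x∈N with x ∈? D
    ... | yes x∈D = y , nbr-in-nbhd x∈D xy
    ... | no x∉D  = x , closed⇒open x∉D x∈N

    nbhd-nonempty : HasEdge (adj G) → ∃[ b ] b ∈N⟨ D ⟩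
    nbhd-nonempty (x , y , xy) = [ meets-nbhd xy , meets-nbhd (~-sym xy) ] (isoD x y xy)

    rigid⇒criticalTripartition : HasEdge (adj G) → (∀ x → x ∈ D → ¬ IsLeaf (adj G) x) →
                                 CriticalTripartitionOf D
    rigid⇒criticalTripartition hasEdge leafless = record
      { neA = nonempty-A (nbhd-nonempty hasEdge)
      ; neB = nbhd-nonempty hasEdge
      ; neC = nonempty-C (nbhd-nonempty hasEdge)
      ; cover = trichotomy
      ; disjAB = λ _ x∈D x∈N → proj₁ x∈N x∈D
      ; disjAC = λ _ x∈D x∉N → x∉N (inj₁ x∈D)
      ; disjBC = λ _ x∈N x∉N → x∉N (inj₂ (proj₂ x∈N))
      ; indepAC = indepAC
      ; indepB = λ _ _ → nbhd-independent
      ; NA≡B = (λ _ → id) , (λ _ → id)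
      ; NC≡B = NC⊆N , N⊆NC
      ; packA = packing
      ; noLeafA = leafless
      }
      where
      nonempty-A : ∃[ b ] b ∈N⟨ D ⟩ → ∃[ d ] d ∈ D
      nonempty-A (_ , _ , d , d∈D , _) = d , d∈D

      nonempty-C : ∃[ b ] b ∈N⟨ D ⟩ → ∃[ c ] ¬ c ∈N[ D ]
      nonempty-C (_ , b∈N) = Product.map₂ proj₂ (outer-nbr b∈N)

      indepAC : Independent (adj G) (λ x → x ∈ D ⊎ ¬ x ∈N[ D ])
      indepAC x y (inj₁ x∈D) (inj₁ y∈D) xy = independent x∈D y∈D xy
      indepAC x y (inj₁ x∈D) (inj₂ y∉N) xy = y∉N (inj₂ (x , x∈D , ~-sym xy))
      indepAC x y (inj₂ x∉N) (inj₁ y∈D) xy = x∉N (inj₂ (y , y∈D , xy))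
      indepAC x y (inj₂ x∉N) (inj₂ y∉N) xy = [ x∉N , y∉N ] (isoD x y xy)

      NC⊆N : ∀ x → InOpenNbhdP (adj G) (λ c → ¬ c ∈N[ D ]) x → x ∈N⟨ D ⟩
      NC⊆N x (¬¬x∈N , c , c∉N , xc) =
        closed⇒open (λ x∈D → c∉N (inj₂ (x , x∈D , ~-sym xc)))
                    (decidable-stable (closedNbhd? D x) ¬¬x∈N)

      N⊆NC : ∀ x → x ∈N⟨ D ⟩ → InOpenNbhdP (adj G) (λ c → ¬ c ∈N[ D ]) x
      N⊆NC x x∈N with outer-nbr x∈N
      ... | c , xc , c∉N = (λ x∉N → x∉N (inj₂ (proj₂ x∈N))) , c , c∉N , xc

  module LeafSwap {b} (minD : MinIsolating (adj G) D) (x∈D : x ∈ D) (xb : x ~ b)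
                  (only : ∀ z → x ~ z → z ≡ b) where

    D′ : Subset n
    D′ = (D - x) ∪ ⁅ b ⁆

    b∈D′ : b ∈ D′
    b∈D′ = x∈p∪q⁺ (inj₂ (x∈⁅x⁆ b))

    x∉D′ : x ∉ D′
    x∉D′ x∈D′ = [ x∉p-x D x , ~-irrefl xb ∘ x∈⁅y⁆⇒x≡y b ] (x∈p∪q⁻ (D - x) ⁅ b ⁆ x∈D′)

    kept : y ∈ D → y ≢ x → y ∈ D′
    kept y∈D y≢x = x∈p∪q⁺ (inj₁ (x∈p∧x≢y⇒x∈p-y y∈D y≢x))

    covered : y ∈N[ D ] → y ∈N[ D′ ]
    covered {y} (inj₁ y∈D) with y ≟ x
    ... | yes refl = inj₂ (b , b∈D′ , xb)
    ... | no y≢x   = inj₁ (kept y∈D y≢x)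
    covered {y} (inj₂ (d , d∈D , yd)) with d ≟ x
    ... | yes refl = inj₁ (subst (_∈ D′) (sym (only y (~-sym yd))) b∈D′)
    ... | no d≢x   = inj₂ (d , kept d∈D d≢x , yd)

    minD′ : MinIsolating (adj G) D′
    minD′ = minIsolating (isolating-mono covered (proj₁ minD))
                         (≤-trans (∣p∪⁅x⁆∣≤1+∣p∣ (D - x) b) (x∈p⇒∣p-x∣<∣p∣ x∈D))
                         (proj₂ minD)

  critical⇒leafless : EdgeCritical → MinIsolating (adj G) D → x ∈ D → ¬ IsLeaf (adj G) x
  critical⇒leafless {D} {x} crit minD x∈D (b , xb , only) =
    uncovered (Rigidity.outer-nbr (proj₁ minD′) (critical⇒rigid crit minD′) (x∉D′ , b , b∈D′ , xb))
    where
    open LeafSwap minD x∈D xb only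
    uncovered : ∃[ c ] (x ~ c × ¬ c ∈N[ D′ ]) → ⊥
    uncovered (c , xc , c∉N) = c∉N (inj₁ (subst (_∈ D′) (sym (only c xc)) b∈D′))

  critical⇒tripartitions : IotaOneCritical G →
                           ∀ D → MinIsolating (adj G) D → CriticalTripartitionOf D
  critical⇒tripartitions (hasEdge , crit) D minD =
    Rigidity.rigid⇒criticalTripartition (proj₁ minD) (critical⇒rigid crit minD) hasEdge
      (λ _ → critical⇒leafless crit minD)

  tripartitions⇒critical : (∀ D → MinIsolating (adj G) D → CriticalTripartitionOf D) →
                           IotaOneCritical G
  tripartitions⇒critical tri = hasEdge , increases
    where
    hasEdge : HasEdge (adj G)
    hasEdge = decidable-stable (any? λ x → any? λ y → T? (adj G x y)) λ edgeless →
      ∉⊥ (proj₂ (CriticalTripartition.neA (tri ∅ (∅-minIsolating edgeless))))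
      where
      ∅-minIsolating : ¬ HasEdge (adj G) → MinIsolating (adj G) ∅
      ∅-minIsolating edgeless =
        minIsolating (λ x y xy → ⊥-elim (edgeless (x , y , xy))) (≤-reflexive (∣⊥∣≡0 n)) (λ _ _ → z≤n)
    increases : EdgeCritical
    increases u v uv D′ iso =
      decidable-stable (anySubset? λ D → isolating? D ×-dec (∣ D ∣ <? ∣ D′ ∣)) λ none →
        Subdivision.no-isolating-minimum u v uv tri D′ iso λ D isoD →
          ≮⇒≥ λ smaller → none (D , isoD , smaller)

theorem4p5 : {n : ℕ} (G : Graph n) → Connected (adj G) →
    (IotaOneCritical G →
      ∀ (D : Subset n) → MinIsolating (adj G) D →
        CriticalTripartition (adj G) (λ x → x ∈ D) (InOpenNbhd (adj G) D)
          (λ x → ¬ InClosedNbhd (adj G) D x))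
    × ((∀ (D : Subset n) → MinIsolating (adj G) D →
        CriticalTripartition (adj G) (λ x → x ∈ D) (InOpenNbhd (adj G) D)
          (λ x → ¬ InClosedNbhd (adj G) D x))
      → IotaOneCritical G)
theorem4p5 G _ = critical⇒tripartitions G , tripartitions⇒critical G
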